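{- Let $G=(V,E)$ be a graph satisfying the standing assumptions and let $u\in V$. Then $\tau(u)=1$ if and only if there exist $k\ge2$ and $z_1,\dots,z_k\in V$ such that (i) $(z_i,z_{i+1})\in E$ for every $1\le i\le k-1$, (ii) $z_k=u$, (iii) $\lambda(z_1)\prec\lambda(z_2)$, and (iv) $\lambda(z_2)=\lambda(z_3)=\dots=\lambda(z_k)$.
   Context: Standing assumptions: $\Sigma$ is a finite alphabet with a total order $\preceq$; $G=(V,E)$ is finite, $E\subseteq V\times V\times\Sigma$, every node has an incoming edge, all edges entering a node $u$ have the same label $\lambda(u)$ (edges are written $(u,v)$), and $G$ is deterministic. An occurrence of $\alpha\in\Sigma^\omega$ starting at $u$ is a sequence $(u_i)_{i\ge1}$ with $u_1=u$, $(u_{i+1},u_i)\in E$, $\lambda(u_i)=\alpha[i]$; $\min_u$ is the lexicographically smallest string in $\Sigma^\omega$ with an occurrence starting at $u$. For $\alpha=a\alpha'$ ($a\in\Sigma$): $\tau(\alpha)=1$ if $\alpha'\prec\alpha$, $2$ if $\alpha'=\alpha$, $3$ if $\alpha\prec\alpha'$; $\tau(u):=\tau(\min_u)$. -}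

module Defs where

open import Data.Nat using (ℕ; zero; suc; _<_; _≤_)
open import Data.Fin using (Fin)
import Data.Fin as F
open import Data.Product using (Σ; ∃; ∃-syntax; _×_; _,_)
open import Data.Sum using (_⊎_)
open import Relation.Binary.PropositionalEquality using (_≡_)

-- Alphabet Σ = Fin σ with the total order of Fin (F._<_); node set V = Fin n.
-- Edge set E ⊆ V × V × Σ given as a relation: E u v a means (u,v,a) ∈ E.
record Graph : Set₁ where
  field
    n σ : ℕ
    E : Fin n → Fin n → Fin σ → Set
    lab : Fin n → Fin σ
    every-node-has-incoming : ∀ v → ∃[ u ] ∃[ a ] E u v a
    incoming-same-label : ∀ {u v a} → E u v a → a ≡ lab v
    deterministic : ∀ {u v w a} → E u v a → E u w a → v ≡ w

-- infinite strings over Fin σ (index 0 is the paper's position 1)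
ωString : ℕ → Set
ωString σ = ℕ → Fin σ

tail : ∀ {σ} → ωString σ → ωString σ
tail α i = α (suc i)

_≐_ : ∀ {σ} → ωString σ → ωString σ → Set
α ≐ β = ∀ i → α i ≡ β i

_≺_ : ∀ {σ} → ωString σ → ωString σ → Set
α ≺ β = ∃[ i ] ((∀ j → j < i → α j ≡ β j) × (α i F.< β i))

_⪯_ : ∀ {σ} → ωString σ → ωString σ → Set
α ⪯ β = (α ≺ β) ⊎ (α ≐ β)

module _ (G : Graph) where
  open Graph G

  IsOccurrence : ωString σ → Fin n → (ℕ → Fin n) → Set
  IsOccurrence α u us =
    (us 0 ≡ u) ×
    (∀ i → ∃[ a ] E (us (suc i)) (us i) a) ×
    (∀ i → lab (us i) ≡ α i)

  HasOccurrence : ωString σ → Fin n → Set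
  HasOccurrence α u = ∃[ us ] IsOccurrence α u us

  IsMin : Fin n → ωString σ → Set
  IsMin u α = HasOccurrence α u × (∀ β → HasOccurrence β u → α ⪯ β)

data τ {σ} (α : ωString σ) : ℕ → Set where
  τ1 : tail α ≺ α → τ α 1
  τ2 : tail α ≐ α → τ α 2
  τ3 : α ≺ tail α → τ α 3

{-# OPTIONS --safe #-}
module Submission where

open import Defs
open import Data.Nat using (ℕ; zero; suc; _≤_; _<_; _∸_; z≤n; s≤s)
open import Data.Nat.Properties
  using (≤-refl; ≤-trans; <-trans; <-cmp; n≤1+n; n<1+n; ∸-monoʳ-≤; n∸n≡0; +-∸-assoc;
         m∸n≤m; m+n∸n≡m)
open import Data.Fin using (Fin)
import Data.Fin as F
import Data.Fin.Properties as FP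
open import Data.Product using (Σ; ∃-syntax; _×_; _,_; proj₁; proj₂)
open import Data.Sum using (inj₁; inj₂)
open import Relation.Binary.PropositionalEquality
open import Relation.Binary.Definitions using (tri<; tri≈; tri>)
open import Relation.Nullary using (contradiction)
open import Function.Bundles using (_⇔_; mk⇔)

-- Since α is the minimum at u, τ(α) = 1 means that α = cᵐ d … with d ≺ c.  An occurrence of
-- such a prefix, read backwards, is exactly a path z₁ … z_k into u with λ(z₁) = d and all
-- later labels c.  Conversely such a path, extended backwards arbitrarily, is an occurrence
-- at u of a string cᵏ⁻¹ d … ; minimality pushes α below it, so α also leaves its leading
-- run of c's downwards, which is τ(α) = 1.

DropsBelow : ∀ {σ} → Fin σ → ωString σ → Set
DropsBelow c α = ∃[ m ] ((∀ j → j < m → α j ≡ c) × α m F.< c)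

module _ {σ} {α : ωString σ} where

  tail≺⇒dropsBelow-head : tail α ≺ α → DropsBelow (α 0) α
  tail≺⇒dropsBelow-head (i , same , drop) =
    suc i , runBelow , subst (α (suc i) F.<_) (run i ≤-refl) drop
    where
    run : ∀ j → j ≤ i → α j ≡ α 0
    run zero    _   = refl
    run (suc j) j<i = trans (same j j<i) (run j (≤-trans (n≤1+n j) j<i))
    runBelow : ∀ j → j < suc i → α j ≡ α 0
    runBelow j (s≤s j≤i) = run j j≤i

  dropsBelow-head⇒tail≺ : DropsBelow (α 0) α → tail α ≺ α
  dropsBelow-head⇒tail≺ (zero , _ , drop) = contradiction refl (FP.<⇒≢ drop)
  dropsBelow-head⇒tail≺ (suc m , run , drop) =
    m , (λ j j<m → trans (run (suc j) (s≤s j<m)) (sym (run j (<-trans j<m (n<1+n m)))))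
      , subst (α (suc m) F.<_) (sym (run m (n<1+n m))) drop

dropsBelow-⪯ : ∀ {σ} {α β : ωString σ} {c : Fin σ} → α ⪯ β → DropsBelow c β → DropsBelow c α
dropsBelow-⪯ (inj₂ α≐β) (m , run , drop) =
  m , (λ j j<m → trans (α≐β j) (run j j<m)) , subst (F._< _) (sym (α≐β m)) drop
dropsBelow-⪯ {α = α} {c = c} (inj₁ (i , agree , αi<βi)) (m , run , drop) with <-cmp i m
... | tri< i<m _ _ = i , (λ j j<i → trans (agree j j<i) (run j (<-trans j<i i<m)))
                       , subst (α i F.<_) (run i i<m) αi<βi
... | tri≈ _ refl _ = i , (λ j j<i → trans (agree j j<i) (run j j<i)) , FP.<-trans αi<βi drop
... | tri> _ _ m<i = m , (λ j j<m → trans (agree j (<-trans j<m m<i)) (run j j<m))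
                       , subst (F._< c) (sym (agree m m<i)) drop

module _ (G : Graph) where
  open Graph G

  RisingRunTo : Fin n → Set
  RisingRunTo u =
    Σ ℕ λ k → Σ (ℕ → Fin n) λ z → (2 ≤ k ×
      (∀ i → 1 ≤ i → i < k → ∃[ a ] E (z i) (z (suc i)) a) ×
      z k ≡ u ×
      lab (z 1) F.< lab (z 2) ×
      (∀ i → 2 ≤ i → i ≤ k → lab (z i) ≡ lab (z 2)))

  occurrence-head : ∀ {α u us} → IsOccurrence G α u us → α 0 ≡ lab u
  occurrence-head (us0≡u , _ , labels) = trans (sym (labels 0)) (cong lab us0≡u)

  dropsBelow-head⇒risingRunTo : ∀ {α u us} → IsOccurrence G α u us →
                                DropsBelow (α 0) α → RisingRunTo u
  dropsBelow-head⇒risingRunTo _ (zero , _ , drop) = contradiction refl (FP.<⇒≢ drop)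
  dropsBelow-head⇒risingRunTo {α} {u} {us} (us0≡u , steps , labels) (suc m , run , drop) =
    suc (suc m) , z , s≤s (s≤s z≤n) , edges , endpoint , labelDrop , labelsConst
    where
    z : ℕ → Fin n
    z j = us (suc (suc m) ∸ j)

    edges : ∀ j → 1 ≤ j → j < suc (suc m) → ∃[ a ] E (z j) (z (suc j)) a
    edges j _ j<k rewrite +-∸-assoc 1 j<k = steps (suc (suc m) ∸ suc j)

    endpoint : z (suc (suc m)) ≡ u
    endpoint rewrite n∸n≡0 (suc (suc m)) = us0≡u

    labelsConst′ : ∀ j → 2 ≤ j → lab (z j) ≡ α 0
    labelsConst′ j 2≤j = trans (labels _) (run _ (s≤s (∸-monoʳ-≤ (suc (suc m)) 2≤j)))

    labelDrop : lab (z 1) F.< lab (z 2)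
    labelDrop = subst₂ F._<_ (sym (labels (suc m))) (sym (labelsConst′ 2 ≤-refl)) drop

    labelsConst : ∀ j → 2 ≤ j → j ≤ suc (suc m) → lab (z j) ≡ lab (z 2)
    labelsConst j 2≤j _ = trans (labelsConst′ j 2≤j) (sym (labelsConst′ 2 ≤-refl))

  predecessor : Fin n → Fin n
  predecessor v = proj₁ (every-node-has-incoming v)

  -- walkBack z r j: the j-th node on the walk z (r + 1), z r, …, z 1 continued by predecessors
  walkBack : (ℕ → Fin n) → ℕ → ℕ → Fin n
  walkBack z r       zero    = z (suc r)
  walkBack z zero    (suc j) = predecessor (walkBack z zero j)
  walkBack z (suc r) (suc j) = walkBack z r j

  walkBack-steps : ∀ {k} z → (∀ i → 1 ≤ i → i < k → ∃[ a ] E (z i) (z (suc i)) a) →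
                   ∀ r j → r < k → ∃[ a ] E (walkBack z r (suc j)) (walkBack z r j) a
  walkBack-steps z path zero    j       _   = proj₂ (every-node-has-incoming (walkBack z zero j))
  walkBack-steps z path (suc r) zero    r<k = path (suc r) (s≤s z≤n) r<k
  walkBack-steps z path (suc r) (suc j) r<k = walkBack-steps z path r j (<-trans (n<1+n r) r<k)

  walkBack-along : ∀ z r j → j ≤ r → walkBack z r j ≡ z (suc r ∸ j)
  walkBack-along z r       zero    _         = refl
  walkBack-along z (suc r) (suc j) (s≤s j≤r) = walkBack-along z r j j≤r

  walkBack-end : ∀ z r → walkBack z r r ≡ z 1
  walkBack-end z zero    = refl
  walkBack-end z (suc r) = walkBack-end z r

  risingRunTo⇒dropsBelow : ∀ {u} → RisingRunTo u →
    ∃[ us ] ∃[ β ] (IsOccurrence G β u us × DropsBelow (lab u) β)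
  risingRunTo⇒dropsBelow {u}
    (suc (suc K) , z , s≤s (s≤s z≤n) , path , endpoint , labelDrop , labelsConst) =
    us , (λ j → lab (us j)) , (endpoint , steps , λ _ → refl) , suc K , leadingRun , lastDrop
    where
    us : ℕ → Fin n
    us = walkBack z (suc K)

    steps : ∀ j → ∃[ a ] E (us (suc j)) (us j) a
    steps j = walkBack-steps z path (suc K) j (n<1+n (suc K))

    lab-z2≡lab-u : lab (z 2) ≡ lab u
    lab-z2≡lab-u = trans (sym (labelsConst _ (s≤s (s≤s z≤n)) ≤-refl)) (cong lab endpoint)

    leadingRun : ∀ j → j < suc K → lab (us j) ≡ lab u
    leadingRun j (s≤s j≤K) = begin
      lab (us j)                ≡⟨ cong lab (walkBack-along z (suc K) j (≤-trans j≤K (n≤1+n K))) ⟩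
      lab (z (suc (suc K) ∸ j)) ≡⟨ labelsConst _ 2≤ (m∸n≤m (suc (suc K)) j) ⟩
      lab (z 2)                 ≡⟨ lab-z2≡lab-u ⟩
      lab u                     ∎
      where
      open ≡-Reasoning
      2≤ : 2 ≤ suc (suc K) ∸ j
      2≤ = subst (_≤ suc (suc K) ∸ j) (m+n∸n≡m 2 K) (∸-monoʳ-≤ (suc (suc K)) j≤K)

    lastDrop : lab (us (suc K)) F.< lab u
    lastDrop = subst₂ F._<_ (cong lab (sym (walkBack-end z (suc K)))) lab-z2≡lab-u labelDrop

  risingRunTo⇒tail≺ : ∀ {u α us} → IsOccurrence G α u us →
                      (∀ β → HasOccurrence G β u → α ⪯ β) → RisingRunTo u → tail α ≺ α
  risingRunTo⇒tail≺ {α = α} occurs minimal entry with risingRunTo⇒dropsBelow entry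
  ... | vs , β , βoccurs , βdrops =
    dropsBelow-head⇒tail≺ (subst (λ c → DropsBelow c α) (sym (occurrence-head occurs))
                             (dropsBelow-⪯ (minimal β (vs , βoccurs)) βdrops))

corollary7 : (G : Graph) → let open Graph G in
    (u : Fin n) (α : ωString σ) → IsMin G u α →
    (τ α 1 ⇔
    (Σ ℕ λ k → Σ (ℕ → Fin n) λ z → (2 ≤ k ×
    (∀ i → 1 ≤ i → i < k → ∃[ a ] E (z i) (z (suc i)) a) ×
    z k ≡ u ×
    lab (z 1) F.< lab (z 2) ×
    (∀ i → 2 ≤ i → i ≤ k → lab (z i) ≡ lab (z 2)))))
corollary7 G u α ((_ , occurs) , minimal) = mk⇔
  (λ { (τ1 descent) → dropsBelow-head⇒risingRunTo G occurs (tail≺⇒dropsBelow-head descent) })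
  (λ entry → τ1 (risingRunTo⇒tail≺ G occurs minimal entry))
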